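{- Let $\Gamma$ be a maximal $\mathbb{SKHM}$-consistent set and $\mathcal{M}^c_\Gamma$ its canonical model. Let $a=\langle\psi',\bot,\phi'\rangle\in\Sigma_\Gamma$ and let $\psi$ be a formula. If $a$ is executable (has at least one $a$-successor) at every $w\in S^c$ with $\psi\in L(w)$, then $\mathcal{U}(\psi\to\psi')\in\Gamma$.
   Context: Formulas: $\phi::=p\mid\neg\phi\mid(\phi\wedge\phi)\mid \mathcal{K}hm(\phi,\phi,\phi)$ over countable $\mathbf{P}$; $\mathcal{U}\phi$ abbreviates $\mathcal{K}hm(\neg\phi,\top,\bot)$. The system $\mathbb{SKHM}$ (with $p,q,r,o,p',q',o'$ proposition letters) has axioms: TAUT all propositional tautologies; DISTU $\mathcal{U}p\wedge\mathcal{U}(p\to q)\to\mathcal{U}q$; TU $\mathcal{U}p\to p$; 4KhmU $\mathcal{K}hm(p,o,q)\to\mathcal{U}\mathcal{K}hm(p,o,q)$; 5KhmU $\neg\mathcal{K}hm(p,o,q)\to\mathcal{U}\neg\mathcal{K}hm(p,o,q)$; EMPKhm $\mathcal{U}(p\to q)\to\mathcal{K}hm(p,\bot,q)$; COMPKhm $\mathcal{K}hm(p,o,r)\wedge\mathcal{K}hm(r,o,q)\wedge\mathcal{U}(r\to o)\to\mathcal{K}hm(p,o,q)$; ONEKhm $\mathcal{K}hm(p,o,q)\wedge\neg\mathcal{K}hm(p,\bot,q)\to\mathcal{K}hm(p,\bot,o)$; UKhm $\mathcal{U}(p'\to p)\wedge\mathcal{U}(o\to o')\wedge\mathcal{U}(q\to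 q')\wedge\mathcal{K}hm(p,o,q)\to\mathcal{K}hm(p',o',q')$; rules MP, NECU, SUB. Canonical model: $\Phi_\Gamma$ is the set of maximal consistent $\Delta$ containing exactly the same $\mathcal{K}hm$-formulas as $\Gamma$. $\Sigma_\Gamma=\{\langle\psi,\bot,\phi\rangle\mid\mathcal{K}hm(\psi,\bot,\phi)\in\Gamma\}\cup\{\langle\chi^\psi,\phi\rangle\mid\mathcal{K}hm(\psi,\chi,\phi)\in\Gamma,\ \neg\mathcal{K}hm(\psi,\bot,\phi)\in\Gamma\}$ (formal symbols; $\chi^\psi$ is a formal marker). $S^c$ is the set of pairs $w=(\Delta,\chi^\psi)$ with $\chi\in\Delta\in\Phi_\Gamma$ such that $\langle\chi^\psi,\phi\rangle\in\Sigma_\Gamma$ for some $\phi$ or $\langle\psi,\bot,\chi\rangle\in\Sigma_\Gamma$; $L(w)=\Delta$, $R(w)=\chi^\psi$. Transitions: $w\xrightarrow{\langle\psi,\bot,\phi\rangle}w'$ iff $\psi\in L(w)$ and $R(w')=\phi^\psi$; $w\xrightarrow{\langle\chi^\psi,\phi\rangle}w'$ iff $R(w)=\chi^\psi$ and $\phi\in L(w')$; $p\in V^c(w)$ iff $p\in L(w)$. -}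

module Defs where

open import Data.Nat using (ℕ)
open import Data.Bool using (Bool; true; false; not; _∧_)
open import Data.List using (List; []; _∷_)
open import Data.List.Relation.Unary.All using (All)
open import Data.Product using (Σ; ∃; _×_; _,_)
open import Data.Sum using (_⊎_)
open import Relation.Nullary using (¬_)
open import Relation.Binary.PropositionalEquality using (_≡_)

infixr 6 _∧ᶠ_
infixr 5 _⇒_

data Form : Set where
  var  : ℕ → Form
  ¬ᶠ   : Form → Form
  _∧ᶠ_ : Form → Form → Form
  Khm  : Form → Form → Form → Form

⊤ᶠ : Form
⊤ᶠ = ¬ᶠ (var 0 ∧ᶠ ¬ᶠ (var 0))

⊥ᶠ : Form
⊥ᶠ = ¬ᶠ ⊤ᶠ

_⇒_ : Form → Form → Form
φ ⇒ ψ = ¬ᶠ (φ ∧ᶠ ¬ᶠ ψ)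

U : Form → Form
U φ = Khm (¬ᶠ φ) ⊤ᶠ ⊥ᶠ

eval : (Form → Bool) → Form → Bool
eval v (var p)     = v (var p)
eval v (¬ᶠ φ)      = not (eval v φ)
eval v (φ ∧ᶠ ψ)    = eval v φ ∧ eval v ψ
eval v (Khm a b c) = v (Khm a b c)

Taut : Form → Set
Taut φ = ∀ (v : Form → Bool) → eval v φ ≡ true

subst : (ℕ → Form) → Form → Form
subst σ (var p)     = σ p
subst σ (¬ᶠ φ)      = ¬ᶠ (subst σ φ)
subst σ (φ ∧ᶠ ψ)    = subst σ φ ∧ᶠ subst σ ψ
subst σ (Khm a b c) = Khm (subst σ a) (subst σ b) (subst σ c)

p q r o p' q' o' : Form
p  = var 0
q  = var 1
r  = var 2
o  = var 3
p' = var 4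
q' = var 5
o' = var 6

data ⊢_ : Form → Set where
  TAUT   : ∀ {φ} → Taut φ → ⊢ φ
  DISTU  : ⊢ ((U p ∧ᶠ U (p ⇒ q)) ⇒ U q)
  TU     : ⊢ (U p ⇒ p)
  4KhmU  : ⊢ (Khm p o q ⇒ U (Khm p o q))
  5KhmU  : ⊢ (¬ᶠ (Khm p o q) ⇒ U (¬ᶠ (Khm p o q)))
  EMPKhm : ⊢ (U (p ⇒ q) ⇒ Khm p ⊥ᶠ q)
  COMPKhm : ⊢ ((Khm p o r ∧ᶠ Khm r o q ∧ᶠ U (r ⇒ o)) ⇒ Khm p o q)
  ONEKhm : ⊢ ((Khm p o q ∧ᶠ ¬ᶠ (Khm p ⊥ᶠ q)) ⇒ Khm p ⊥ᶠ o)
  UKhm   : ⊢ ((U (p' ⇒ p) ∧ᶠ U (o ⇒ o') ∧ᶠ U (q ⇒ q') ∧ᶠ Khm p o q)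
               ⇒ Khm p' o' q')
  MP     : ∀ {φ ψ} → ⊢ φ → ⊢ (φ ⇒ ψ) → ⊢ ψ
  NECU   : ∀ {φ} → ⊢ φ → ⊢ U φ
  SUB    : ∀ {φ} (σ : ℕ → Form) → ⊢ φ → ⊢ subst σ φ

FSet : Set₁
FSet = Form → Set

_⊆_ : FSet → FSet → Set
A ⊆ B = ∀ φ → A φ → B φ

conj : List Form → Form
conj []       = ⊤ᶠ
conj (φ ∷ φs) = φ ∧ᶠ conj φs

Consistent : FSet → Set
Consistent Γ = ¬ (Σ (List Form) λ φs → All Γ φs × (⊢ ¬ᶠ (conj φs)))

MCS : FSet → Set₁
MCS Γ = Consistent Γ × (∀ (Δ : FSet) → Γ ⊆ Δ → Consistent Δ → Δ ⊆ Γ)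

_⇔_ : Set → Set → Set
A ⇔ B = (A → B) × (B → A)

InΦ : FSet → FSet → Set₁
InΦ Γ Δ = MCS Δ × (∀ a b c → Δ (Khm a b c) ⇔ Γ (Khm a b c))

data Act : Set where
  ⟨_,⊥,_⟩ : Form → Form → Act
  ⟨_^_,_⟩ : Form → Form → Form → Act

InΣ : FSet → Act → Set
InΣ Γ ⟨ ψ ,⊥, φ ⟩   = Γ (Khm ψ ⊥ᶠ φ)
InΣ Γ ⟨ χ ^ ψ , φ ⟩ = Γ (Khm ψ χ φ) × Γ (¬ᶠ (Khm ψ ⊥ᶠ φ))

-- the formal marker χ^ψ is represented by the pair (χ , ψ)
Marker : Set
Marker = Form × Form

record State (Γ : FSet) : Set₁ where
  field
    L    : FSet
    L∈Φ  : InΦ Γ L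
    χ    : Form
    ψ    : Form
    χ∈L  : L χ
    ok   : (∃ λ φ → InΣ Γ ⟨ χ ^ ψ , φ ⟩) ⊎ InΣ Γ ⟨ ψ ,⊥, χ ⟩

  R : Marker
  R = (χ , ψ)

open State public

Trans : (Γ : FSet) → State Γ → Act → State Γ → Set
Trans Γ w ⟨ ψ ,⊥, φ ⟩   w' = L w ψ × (R w' ≡ (φ , ψ))
Trans Γ w ⟨ χ ^ ψ , φ ⟩ w' = (R w ≡ (χ , ψ)) × L w' φ

V : (Γ : FSet) → State Γ → ℕ → Set
V Γ w n = L w (var n)

-- Suppose U(ψ → ψ') ∉ Γ. Then {χ | Uχ ∈ Γ} ∪ {¬(ψ → ψ')} is consistent (DISTU,
-- NECU), and a Lindenbaum extension Δ of it has, by 4KhmU and 5KhmU, exactly the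
-- Khm-formulas of Γ, so Δ ∈ Φ_Γ. Since Khm(p, ⊥, ⊤) ∈ Γ by EMPKhm, (Δ, ⊤^p) is a
-- state of the canonical model at which ψ holds; executing ⟨ψ', ⊥, φ'⟩ there puts
-- ψ' into Δ, contradicting ¬(ψ → ψ') ∈ Δ.
module Submission where

open import Defs
open import Data.Bool as Bool using (Bool; true; _∧_)
open import Data.Bool.Properties using (not-¬; ¬-not)
open import Data.Empty using (⊥-elim)
open import Data.List using (List; []; _∷_; _++_)
open import Data.List.Relation.Unary.All as All using (All; []; _∷_)
open import Data.List.Relation.Unary.All.Properties using (++⁺)
open import Data.Nat using (ℕ; zero; suc; _+_; _≤_; s≤s; _⊔_; _≤′_; ≤′-refl; ≤′-step)
open import Data.Nat.Properties using (+-suc; +-identityʳ; m≤m⊔n; m≤n⊔m; ≤-trans; ≤⇒≤′; ≤-refl)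
open import Data.Product using (Σ; ∃; _×_; _,_; proj₁; proj₂; uncurry)
open import Data.Sum using (_⊎_; inj₁; inj₂)
open import Function using (_∘_)
open import Relation.Nullary using (¬_)
open import Relation.Nullary.Decidable using (decidable-stable)
open import Relation.Binary.PropositionalEquality as Eq
  using (_≡_; refl; sym; trans; cong; cong₂)

-- Defs builds ⊤ᶠ from the letter p, so a substitution instance of an axiom
-- mentions U[ t ] for the image t of p rather than U itself.

⊤[_] : Form → Form
⊤[ t ] = ¬ᶠ (t ∧ᶠ ¬ᶠ t)

U[_]_ : Form → Form → Form
U[ t ] φ = Khm (¬ᶠ φ) ⊤[ t ] (¬ᶠ ⊤[ t ])

∧-true : ∀ {x y} → x ∧ y ≡ true → x ≡ true × y ≡ true
∧-true {true} {true} _ = refl , refl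

record _⊨_ (v : Form → Bool) (φ : Form) : Set where
  constructor holds
  field truth : eval v φ ≡ true
open _⊨_

module _ {v : Form → Bool} where

  ¬ᶠ-intro : ∀ {a} → ¬ v ⊨ a → v ⊨ ¬ᶠ a
  ¬ᶠ-intro h = holds (sym (¬-not (λ e → h (holds (sym e)))))

  ¬ᶠ-elim : ∀ {a} → v ⊨ ¬ᶠ a → ¬ v ⊨ a
  ¬ᶠ-elim (holds e) (holds e′) = not-¬ (sym e′) (sym e)

  ⊨-stable : ∀ {a} → ¬ ¬ v ⊨ a → v ⊨ a
  ⊨-stable {a} h = holds (decidable-stable (eval v a Bool.≟ true) (λ n → h (n ∘ truth)))

  ∧ᶠ-intro : ∀ {a b} → v ⊨ a → v ⊨ b → v ⊨ (a ∧ᶠ b)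
  ∧ᶠ-intro (holds e) (holds e′) = holds (cong₂ _∧_ e e′)

  ∧ᶠ-elim : ∀ {a b} → v ⊨ (a ∧ᶠ b) → v ⊨ a × v ⊨ b
  ∧ᶠ-elim (holds e) with ∧-true e
  ... | ea , eb = holds ea , holds eb

  ⇒-intro : ∀ {a b} → (v ⊨ a → v ⊨ b) → v ⊨ (a ⇒ b)
  ⇒-intro h = ¬ᶠ-intro (λ e → ¬ᶠ-elim (proj₂ (∧ᶠ-elim e)) (h (proj₁ (∧ᶠ-elim e))))

  ⇒-elim : ∀ {a b} → v ⊨ (a ⇒ b) → v ⊨ a → v ⊨ b
  ⇒-elim e ea = ⊨-stable (λ nb → ¬ᶠ-elim e (∧ᶠ-intro ea (¬ᶠ-intro nb)))

  ⊤[]-holds : ∀ t → v ⊨ ⊤[ t ]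
  ⊤[]-holds t = ¬ᶠ-intro (λ e → ¬ᶠ-elim (proj₂ (∧ᶠ-elim e)) (proj₁ (∧ᶠ-elim e)))

  ⊤ᶠ-holds : v ⊨ ⊤ᶠ
  ⊤ᶠ-holds = ⊤[]-holds p

  conj-++⁻ : ∀ xs ys → v ⊨ conj (xs ++ ys) → v ⊨ conj xs × v ⊨ conj ys
  conj-++⁻ []       ys e = ⊤ᶠ-holds , e
  conj-++⁻ (x ∷ xs) ys e with ∧ᶠ-elim e
  ... | ex , exs with conj-++⁻ xs ys exs
  ...   | exs′ , eys = ∧ᶠ-intro ex exs′ , eys

_⇛_ : Form → Form → Set
a ⇛ b = ∀ v → v ⊨ a → v ⊨ b

tautology : ∀ {φ} → (∀ v → v ⊨ φ) → ⊢ φ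
tautology h = TAUT (truth ∘ h)

⊢-⇛ : ∀ {a b} → a ⇛ b → ⊢ a → ⊢ b
⊢-⇛ h ⊢a = MP ⊢a (tautology (λ v → ⇒-intro (h v)))

⊢-∧ : ∀ {a b} → ⊢ a → ⊢ b → ⊢ (a ∧ᶠ b)
⊢-∧ ⊢a ⊢b = MP ⊢b (MP ⊢a (tautology (λ v → ⇒-intro (λ ea → ⇒-intro (∧ᶠ-intro ea)))))

⊢-⇛₂ : ∀ {a b c} → (∀ v → v ⊨ a → v ⊨ b → v ⊨ c) → ⊢ a → ⊢ b → ⊢ c
⊢-⇛₂ h ⊢a ⊢b = ⊢-⇛ (λ v e → uncurry (h v) (∧ᶠ-elim e)) (⊢-∧ ⊢a ⊢b)

⊢-⇒-trans : ∀ {a b c} → ⊢ (a ⇒ b) → ⊢ (b ⇒ c) → ⊢ (a ⇒ c)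
⊢-⇒-trans = ⊢-⇛₂ (λ v ab bc → ⇒-intro (⇒-elim bc ∘ ⇒-elim ab))

⟪_,_,_,_,_,_,_⟫ : Form → Form → Form → Form → Form → Form → Form → ℕ → Form
⟪ a , _ , _ , _ , _ , _ , _ ⟫ 0 = a
⟪ _ , b , _ , _ , _ , _ , _ ⟫ 1 = b
⟪ _ , _ , c , _ , _ , _ , _ ⟫ 2 = c
⟪ _ , _ , _ , d , _ , _ , _ ⟫ 3 = d
⟪ _ , _ , _ , _ , e , _ , _ ⟫ 4 = e
⟪ _ , _ , _ , _ , _ , f , _ ⟫ 5 = f
⟪ _ , _ , _ , _ , _ , _ , g ⟫ 6 = g
⟪ _ , _ , _ , _ , _ , _ , _ ⟫ n = var n

unshift : Form → ℕ → Form
unshift t zero    = t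
unshift t (suc i) = var i

subst-unshift-shift : ∀ t φ → subst (unshift t) (subst (var ∘ suc) φ) ≡ φ
subst-unshift-shift t (var i)     = refl
subst-unshift-shift t (¬ᶠ φ)      = cong ¬ᶠ (subst-unshift-shift t φ)
subst-unshift-shift t (a ∧ᶠ b)    = cong₂ _∧ᶠ_ (subst-unshift-shift t a) (subst-unshift-shift t b)
subst-unshift-shift t (Khm a b c)
  rewrite subst-unshift-shift t a | subst-unshift-shift t b | subst-unshift-shift t c = refl

-- Move the letters of φ off p, apply NECU, then substitute t for p.
U[]-nec : ∀ t {φ} → ⊢ φ → ⊢ U[ t ] φ
U[]-nec t {φ} ⊢φ =
  Eq.subst (⊢_ ∘ U[ t ]_) (subst-unshift-shift t φ)
           (SUB (unshift t) (NECU (SUB (var ∘ suc) ⊢φ)))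

U[]-change : ∀ t s φ → ⊢ (U[ t ] φ ⇒ U[ s ] φ)
U[]-change t s φ =
  ⊢-⇛₂ (λ v ax prems → ⇒-intro (λ u → ⇒-elim ax (premises v prems u)))
       (SUB ⟪ ¬ᶠ φ , ¬ᶠ ⊤[ t ] , r , ⊤[ t ] , ¬ᶠ φ , ¬ᶠ ⊤[ s ] , ⊤[ s ] ⟫ UKhm)
       (⊢-∧ (U[]-nec (¬ᶠ φ) (tautology (λ v → ⇒-intro (λ e → e))))
            (⊢-∧ (U[]-nec (¬ᶠ φ) (tautology (λ v → ⇒-intro (λ _ → ⊤[]-holds s))))
                 (U[]-nec (¬ᶠ φ) (tautology (λ v → ⇒-intro (λ e → ⊥-elim (¬ᶠ-elim e (⊤[]-holds t))))))))
  where
  premises : ∀ v {a b c d} → v ⊨ (a ∧ᶠ b ∧ᶠ c) → v ⊨ d → v ⊨ (a ∧ᶠ b ∧ᶠ c ∧ᶠ d)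
  premises v abc ed with ∧ᶠ-elim abc
  ... | ea , bc with ∧ᶠ-elim bc
  ...   | eb , ec = ∧ᶠ-intro ea (∧ᶠ-intro eb (∧ᶠ-intro ec ed))

U-dist : ∀ a b → ⊢ ((U a ∧ᶠ U (a ⇒ b)) ⇒ U b)
U-dist a b =
  ⊢-⇛₂ (λ v ax changes → ⇒-intro (λ e → chain v ax changes (∧ᶠ-elim e)))
       (SUB ⟪ a , b , r , o , p' , q' , o' ⟫ DISTU)
       (⊢-∧ (U[]-change p a a) (⊢-∧ (U[]-change p a (a ⇒ b)) (U[]-change a p b)))
  where
  chain : ∀ v {x y z x′ y′ z′} → v ⊨ ((x ∧ᶠ y) ⇒ z)
        → v ⊨ ((x′ ⇒ x) ∧ᶠ (y′ ⇒ y) ∧ᶠ (z ⇒ z′)) → v ⊨ x′ × v ⊨ y′ → v ⊨ z′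
  chain v ax changes (ex , ey) with ∧ᶠ-elim changes
  ... | cx , cyz with ∧ᶠ-elim cyz
  ...   | cy , cz = ⇒-elim cz (⇒-elim ax (∧ᶠ-intro (⇒-elim cx ex) (⇒-elim cy ey)))

Khm-U : ∀ a b c → ⊢ (Khm a b c ⇒ U (Khm a b c))
Khm-U a b c = ⊢-⇒-trans (SUB ⟪ a , c , r , b , p' , q' , o' ⟫ 4KhmU) (U[]-change a p _)

¬Khm-U : ∀ a b c → ⊢ (¬ᶠ (Khm a b c) ⇒ U (¬ᶠ (Khm a b c)))
¬Khm-U a b c = ⊢-⇒-trans (SUB ⟪ a , c , r , b , p' , q' , o' ⟫ 5KhmU) (U[]-change a p _)

Khm-p⊥⊤ : ⊢ Khm p ⊥ᶠ ⊤ᶠ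
Khm-p⊥⊤ = MP (NECU (tautology (λ v → ⇒-intro (λ _ → ⊤ᶠ-holds))))
             (SUB ⟪ p , ⊤ᶠ , r , o , p' , q' , o' ⟫ EMPKhm)

_⊢ˢ_ : FSet → Form → Set
A ⊢ˢ φ = Σ (List Form) λ φs → All A φs × ⊢ (conj φs ⇒ φ)

_∪_ : FSet → Form → FSet
(A ∪ φ) χ = A χ ⊎ χ ≡ φ

module _ {A : FSet} where

  ⊢ˢ-member : ∀ {φ} → A φ → A ⊢ˢ φ
  ⊢ˢ-member a = _ ∷ [] , a ∷ [] , tautology (λ v → ⇒-intro (proj₁ ∘ ∧ᶠ-elim))

  ⊢ˢ-theorem : ∀ {φ} → ⊢ φ → A ⊢ˢ φ
  ⊢ˢ-theorem ⊢φ = [] , [] , ⊢-⇛ (λ v eφ → ⇒-intro (λ _ → eφ)) ⊢φ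

  ⊢ˢ-⇛₂ : ∀ {a b c} → (∀ v → v ⊨ a → v ⊨ b → v ⊨ c) → A ⊢ˢ a → A ⊢ˢ b → A ⊢ˢ c
  ⊢ˢ-⇛₂ h (xs , Axs , ⊢a) (ys , Ays , ⊢b) =
    xs ++ ys , ++⁺ Axs Ays ,
    ⊢-⇛₂ (λ v ea eb → ⇒-intro (λ e → uncurry (λ ex ey → h v (⇒-elim ea ex) (⇒-elim eb ey))
                                              (conj-++⁻ xs ys e)))
         ⊢a ⊢b

  ⊢ˢ-⇛ : ∀ {a b} → a ⇛ b → A ⊢ˢ a → A ⊢ˢ b
  ⊢ˢ-⇛ h d = ⊢ˢ-⇛₂ (λ v ea _ → h v ea) d d

  ⊢ˢ-mp : ∀ {a b} → ⊢ (a ⇒ b) → A ⊢ˢ a → A ⊢ˢ b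
  ⊢ˢ-mp ⊢ab d = ⊢ˢ-⇛₂ (λ v ea eab → ⇒-elim eab ea) d (⊢ˢ-theorem ⊢ab)

  ⊢ˢ-⊥⇒¬consistent : A ⊢ˢ ⊥ᶠ → ¬ Consistent A
  ⊢ˢ-⊥⇒¬consistent (xs , Axs , ⊢x⊥) cons =
    cons (xs , Axs , ⊢-⇛ (λ v e → ¬ᶠ-intro (λ ex → ¬ᶠ-elim (⇒-elim e ex) ⊤ᶠ-holds)) ⊢x⊥)

  refutation⇒⊢ˢ⊥ : Σ (List Form) (λ φs → All A φs × ⊢ ¬ᶠ (conj φs)) → A ⊢ˢ ⊥ᶠ
  refutation⇒⊢ˢ⊥ (xs , Axs , ⊢¬x) =
    xs , Axs , ⊢-⇛ (λ v e → ⇒-intro (λ ex → ⊥-elim (¬ᶠ-elim e ex))) ⊢¬x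

  discharge : ∀ {φ} xs → All (A ∪ φ) xs →
    Σ (List Form) λ ys → All A ys × (∀ v → v ⊨ conj ys → v ⊨ φ → v ⊨ conj xs)
  discharge []       []             = [] , [] , λ v _ _ → ⊤ᶠ-holds
  discharge (x ∷ xs) (inj₁ a ∷ Axs) with discharge xs Axs
  ... | ys , Ays , h =
    x ∷ ys , a ∷ Ays , λ v e eφ → ∧ᶠ-intro (proj₁ (∧ᶠ-elim e)) (h v (proj₂ (∧ᶠ-elim e)) eφ)
  discharge (x ∷ xs) (inj₂ refl ∷ Axs) with discharge xs Axs
  ... | ys , Ays , h = ys , Ays , λ v e eφ → ∧ᶠ-intro eφ (h v e eφ)

  deduction : ∀ {φ χ} → (A ∪ φ) ⊢ˢ χ → A ⊢ˢ (φ ⇒ χ)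
  deduction (xs , Axs , ⊢xχ) with discharge xs Axs
  ... | ys , Ays , h =
    ys , Ays , ⊢-⇛ (λ v e → ⇒-intro (λ ey → ⇒-intro (λ eφ → ⇒-elim e (h v ey eφ)))) ⊢xχ

  ⊢ˢ-contradiction : ∀ {φ} → A ⊢ˢ φ → A ⊢ˢ ¬ᶠ φ → A ⊢ˢ ⊥ᶠ
  ⊢ˢ-contradiction = ⊢ˢ-⇛₂ (λ v eφ e¬φ → ⊥-elim (¬ᶠ-elim e¬φ eφ))

  consistent-antitone : ∀ {B} → A ⊆ B → Consistent B → Consistent A
  consistent-antitone A⊆B cons (xs , Axs , ⊢¬x) = cons (xs , All.map (A⊆B _) Axs , ⊢¬x)

module _ {Γ : FSet} (mcs : MCS Γ) where

  MCS-consistent : ¬ Γ ⊢ˢ ⊥ᶠ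
  MCS-consistent d = ⊢ˢ-⊥⇒¬consistent d (proj₁ mcs)

  MCS-⊬¬⇒∈ : ∀ {φ} → ¬ Γ ⊢ˢ ¬ᶠ φ → Γ φ
  MCS-⊬¬⇒∈ {φ} ¬⊢¬φ =
    proj₂ mcs (Γ ∪ φ) (λ _ → inj₁)
      (λ r → ¬⊢¬φ (⊢ˢ-⇛ (λ v e → ¬ᶠ-intro (λ eφ → ¬ᶠ-elim (⇒-elim e eφ) ⊤ᶠ-holds))
                        (deduction (refutation⇒⊢ˢ⊥ r))))
      φ (inj₂ refl)

  MCS-closed : ∀ {φ} → Γ ⊢ˢ φ → Γ φ
  MCS-closed d = MCS-⊬¬⇒∈ (MCS-consistent ∘ ⊢ˢ-contradiction d)

  MCS-complete : ∀ {φ} → ¬ Γ (¬ᶠ φ) → Γ φ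
  MCS-complete ¬φ∉Γ = MCS-⊬¬⇒∈ (¬φ∉Γ ∘ MCS-closed)

-- Cantor's enumeration, walking each anti-diagonal from (0 , s) to (s , 0).
next : ℕ × ℕ → ℕ × ℕ
next (a , zero)  = zero , suc a
next (a , suc b) = suc a , b

unpair : ℕ → ℕ × ℕ
unpair zero    = zero , zero
unpair (suc n) = next (unpair n)

unpair-along-diagonal : ∀ a b {n} → unpair n ≡ (0 , a + b) → unpair (a + n) ≡ (a , b)
unpair-along-diagonal zero    b e = e
unpair-along-diagonal (suc a) b e =
  cong next (unpair-along-diagonal a (suc b) (trans e (cong (0 ,_) (sym (+-suc a b)))))

unpair-diagonal-start : ∀ s → ∃ λ n → unpair n ≡ (0 , s)
unpair-diagonal-start zero = zero , refl
unpair-diagonal-start (suc s) with unpair-diagonal-start s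
... | n , e = suc (s + n) ,
  cong next (unpair-along-diagonal s 0 (trans e (cong (0 ,_) (sym (+-identityʳ s)))))

unpair-surjective : ∀ a b → ∃ λ n → unpair n ≡ (a , b)
unpair-surjective a b with unpair-diagonal-start (a + b)
... | n , e = a + n , unpair-along-diagonal a b e

unpairʳ : ℕ × ℕ → ℕ × ℕ × ℕ
unpairʳ (i , k) = i , unpair k

unpair₃ : ℕ → ℕ × ℕ × ℕ
unpair₃ = unpairʳ ∘ unpair

unpair₃-surjective : ∀ a b c → ∃ λ n → unpair₃ n ≡ (a , b , c)
unpair₃-surjective a b c with unpair-surjective b c
... | k , ek with unpair-surjective a k
...   | n , en = n , trans (cong unpairʳ en) (cong (a ,_) ek)

-- The first argument is fuel: decode d reaches exactly the formulas of height ≤ d.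
decode : ℕ → ℕ → Form
decodeNode : ℕ → ℕ × ℕ → Form
conjOf : ℕ → ℕ × ℕ → Form
khmOf : ℕ → ℕ × ℕ × ℕ → Form

decode zero    n = var n
decode (suc d) n = decodeNode d (unpair n)

decodeNode d (0 , m)                 = var m
decodeNode d (1 , m)                 = ¬ᶠ (decode d m)
decodeNode d (2 , m)                 = conjOf d (unpair m)
decodeNode d (suc (suc (suc _)) , m) = khmOf d (unpair₃ m)

conjOf d (i , j) = decode d i ∧ᶠ decode d j

khmOf d (i , j , k) = Khm (decode d i) (decode d j) (decode d k)

height : Form → ℕ
height (var _)     = 0
height (¬ᶠ φ)      = suc (height φ)
height (a ∧ᶠ b)    = suc (height a ⊔ height b)
height (Khm a b c) = suc (height a ⊔ (height b ⊔ height c))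

Decodes : ℕ → Form → Set
Decodes d φ = ∃ λ m → decode d m ≡ φ

decodeNode⇒Decodes : ∀ d t m {φ} → decodeNode d (t , m) ≡ φ → Decodes (suc d) φ
decodeNode⇒Decodes d t m e with unpair-surjective t m
... | n , en = n , trans (cong (decodeNode d) en) e

decode-surjective : ∀ φ d → height φ ≤ d → Decodes d φ
decode-surjective (var n) zero    _ = n , refl
decode-surjective (var n) (suc d) _ = decodeNode⇒Decodes d 0 n refl
decode-surjective (¬ᶠ φ) (suc d) (s≤s h) with decode-surjective φ d h
... | i , refl = decodeNode⇒Decodes d 1 i refl
decode-surjective (a ∧ᶠ b) (suc d) (s≤s h)
  with decode-surjective a d (≤-trans (m≤m⊔n _ _) h)
     | decode-surjective b d (≤-trans (m≤n⊔m _ _) h)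
... | i , refl | j , refl with unpair-surjective i j
...   | m , em = decodeNode⇒Decodes d 2 m (cong (conjOf d) em)
decode-surjective (Khm a b c) (suc d) (s≤s h)
  with decode-surjective a d (≤-trans (m≤m⊔n _ _) h)
     | decode-surjective b d (≤-trans (≤-trans (m≤m⊔n _ _) (m≤n⊔m (height a) _)) h)
     | decode-surjective c d (≤-trans (≤-trans (m≤n⊔m _ _) (m≤n⊔m (height a) _)) h)
... | i , refl | j , refl | k , refl with unpair₃-surjective i j k
...   | m , em = decodeNode⇒Decodes d 3 m (cong (khmOf d) em)

enumerate : ℕ → Form
enumerate = uncurry decode ∘ unpair

enumerate-surjective : ∀ φ → ∃ λ n → enumerate n ≡ φ
enumerate-surjective φ with decode-surjective φ (height φ) ≤-refl
... | m , e with unpair-surjective (height φ) m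
...   | n , en = n , trans (cong (uncurry decode) en) e

module Lindenbaum (A : FSet) (A-consistent : Consistent A) where

  stage : ℕ → FSet
  stage zero      = A
  stage (suc n) χ = stage n χ ⊎ (χ ≡ enumerate n × Consistent (stage n ∪ enumerate n))

  stage-mono : ∀ {n m} → n ≤′ m → stage n ⊆ stage m
  stage-mono ≤′-refl        _ s = s
  stage-mono (≤′-step n≤′m) χ s = inj₁ (stage-mono n≤′m χ s)

  stage-suc-⊆ : ∀ n → stage (suc n) ⊆ (stage n ∪ enumerate n)
  stage-suc-⊆ n _ (inj₁ s)       = inj₁ s
  stage-suc-⊆ n _ (inj₂ (e , _)) = inj₂ e

  stage-suc-split : ∀ n xs → All (stage (suc n)) xs →
    All (stage n) xs ⊎ Consistent (stage n ∪ enumerate n)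
  stage-suc-split n []       []                  = inj₁ []
  stage-suc-split n (x ∷ xs) (inj₂ (_ , c) ∷ _)  = inj₂ c
  stage-suc-split n (x ∷ xs) (inj₁ s ∷ ss) with stage-suc-split n xs ss
  ... | inj₁ ss′ = inj₁ (s ∷ ss′)
  ... | inj₂ c   = inj₂ c

  stage-consistent : ∀ n → Consistent (stage n)
  stage-consistent zero = A-consistent
  stage-consistent (suc n) (xs , ss , ⊢¬x) with stage-suc-split n xs ss
  ... | inj₁ ss′ = stage-consistent n (xs , ss′ , ⊢¬x)
  ... | inj₂ c   = consistent-antitone (stage-suc-⊆ n) c (xs , ss , ⊢¬x)

  Δ : FSet
  Δ χ = ∃ λ n → stage n χ

  All-stage : ∀ xs → All Δ xs → ∃ λ n → All (stage n) xs
  All-stage []       []                = 0 , []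
  All-stage (x ∷ xs) ((n , s) ∷ Δxs) with All-stage xs Δxs
  ... | m , ss = n ⊔ m , stage-mono (≤⇒≤′ (m≤m⊔n n m)) x s
                       ∷ All.map (stage-mono (≤⇒≤′ (m≤n⊔m n m)) _) ss

  Δ-consistent : Consistent Δ
  Δ-consistent (xs , Δxs , ⊢¬x) with All-stage xs Δxs
  ... | n , ss = stage-consistent n (xs , ss , ⊢¬x)

  Δ-maximal : ∀ Θ → Δ ⊆ Θ → Consistent Θ → Θ ⊆ Δ
  Δ-maximal Θ Δ⊆Θ Θ-consistent θ θ∈Θ with enumerate-surjective θ
  ... | n , refl = suc n , inj₂ (refl , consistent-antitone stage∪θ⊆Θ Θ-consistent)
    where
    stage∪θ⊆Θ : (stage n ∪ enumerate n) ⊆ Θ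
    stage∪θ⊆Θ χ (inj₁ s)    = Δ⊆Θ χ (n , s)
    stage∪θ⊆Θ χ (inj₂ refl) = θ∈Θ

lindenbaum : ∀ {A} → Consistent A → Σ FSet λ Δ → MCS Δ × A ⊆ Δ
lindenbaum {A} A-consistent = Δ , (Δ-consistent , Δ-maximal) , λ _ → 0 ,_
  where open Lindenbaum A A-consistent

U⁻ : FSet → FSet
U⁻ A χ = A (U χ)

module _ {A : FSet} where

  ⊢ˢ-U-mp : ∀ {a b} → A ⊢ˢ U a → A ⊢ˢ U (a ⇒ b) → A ⊢ˢ U b
  ⊢ˢ-U-mp {a} {b} Ua Uab = ⊢ˢ-mp (U-dist a b) (⊢ˢ-⇛₂ (λ v → ∧ᶠ-intro) Ua Uab)

  ⊢ˢ-U-mono : ∀ {a b} → ⊢ (a ⇒ b) → A ⊢ˢ U a → A ⊢ˢ U b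
  ⊢ˢ-U-mono ⊢ab Ua = ⊢ˢ-U-mp Ua (⊢ˢ-theorem (NECU ⊢ab))

  ⊢ˢ-U-conj : ∀ xs → All (U⁻ A) xs → A ⊢ˢ U (conj xs)
  ⊢ˢ-U-conj []       []          = ⊢ˢ-theorem (NECU (tautology (λ v → ⊤ᶠ-holds)))
  ⊢ˢ-U-conj (x ∷ xs) (Ux ∷ Uxs) =
    ⊢ˢ-U-mp (⊢ˢ-U-conj xs Uxs)
            (⊢ˢ-U-mono (tautology (λ v → ⇒-intro (λ ex → ⇒-intro (∧ᶠ-intro ex)))) (⊢ˢ-member Ux))

  ⊢ˢ-U-lift : ∀ {χ} → U⁻ A ⊢ˢ χ → A ⊢ˢ U χ
  ⊢ˢ-U-lift (xs , Uxs , ⊢xχ) = ⊢ˢ-U-mono ⊢xχ (⊢ˢ-U-conj xs Uxs)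

module _ {Γ : FSet} (mcs : MCS Γ) where

  U⁻-∪-consistent : ∀ {φ} → Γ (¬ᶠ (U φ)) → Consistent (U⁻ Γ ∪ ¬ᶠ φ)
  U⁻-∪-consistent ¬Uφ∈Γ r =
    MCS-consistent mcs
      (⊢ˢ-contradiction
        (⊢ˢ-U-lift (⊢ˢ-⇛ (λ v e → ⊨-stable (λ ¬eφ → ¬ᶠ-elim (⇒-elim e (¬ᶠ-intro ¬eφ)) ⊤ᶠ-holds))
                          (deduction (refutation⇒⊢ˢ⊥ r))))
        (⊢ˢ-member ¬Uφ∈Γ))

  U⁻-extension-∈Φ : ∀ {Δ} → MCS Δ → U⁻ Γ ⊆ Δ → InΦ Γ Δ
  U⁻-extension-∈Φ {Δ} Δ-mcs U⁻Γ⊆Δ = Δ-mcs , λ a b c → Δ→Γ a b c , Γ→Δ a b c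
    where
    Γ→Δ : ∀ a b c → Γ (Khm a b c) → Δ (Khm a b c)
    Γ→Δ a b c k = U⁻Γ⊆Δ _ (MCS-closed mcs (⊢ˢ-mp (Khm-U a b c) (⊢ˢ-member k)))

    Δ→Γ : ∀ a b c → Δ (Khm a b c) → Γ (Khm a b c)
    Δ→Γ a b c k = MCS-complete mcs λ ¬k →
      MCS-consistent Δ-mcs
        (⊢ˢ-contradiction (⊢ˢ-member k)
          (⊢ˢ-member (U⁻Γ⊆Δ _ (MCS-closed mcs (⊢ˢ-mp (¬Khm-U a b c) (⊢ˢ-member ¬k))))))

  -- (Δ, ⊤^p) is a state because Khm(p, ⊥, ⊤) ∈ Γ.
  ⊤-state : ∀ {Δ} → InΦ Γ Δ → State Γ
  ⊤-state {Δ} Δ∈Φ = record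
    { L   = Δ
    ; L∈Φ = Δ∈Φ
    ; χ   = ⊤ᶠ
    ; ψ   = p
    ; χ∈L = MCS-closed (proj₁ Δ∈Φ) (⊢ˢ-theorem (tautology (λ v → ⊤ᶠ-holds)))
    ; ok  = inj₂ (MCS-closed mcs (⊢ˢ-theorem Khm-p⊥⊤))
    }

proposition10 : (Γ : FSet) → MCS Γ → (ψ' φ' ψ : Form)
    → InΣ Γ ⟨ ψ' ,⊥, φ' ⟩
    → (∀ (w : State Γ) → L w ψ → ∃ λ (w' : State Γ) → Trans Γ w ⟨ ψ' ,⊥, φ' ⟩ w')
    → Γ (U (ψ ⇒ ψ'))
proposition10 Γ mcs ψ' φ' ψ _ executable = MCS-complete mcs refuted
  where
  refuted : ¬ Γ (¬ᶠ (U (ψ ⇒ ψ')))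
  refuted ¬U∈Γ with lindenbaum (U⁻-∪-consistent mcs ¬U∈Γ)
  ... | Δ , Δ-mcs , extends =
    MCS-consistent Δ-mcs
      (⊢ˢ-contradiction (⊢ˢ-⇛ (λ v eψ' → ⇒-intro (λ _ → eψ')) (⊢ˢ-member ψ'∈Δ)) Δ⊢¬[ψ⇒ψ'])
    where
    Δ⊢¬[ψ⇒ψ'] : Δ ⊢ˢ ¬ᶠ (ψ ⇒ ψ')
    Δ⊢¬[ψ⇒ψ'] = ⊢ˢ-member (extends _ (inj₂ refl))

    ψ∈Δ : Δ ψ
    ψ∈Δ = MCS-closed Δ-mcs (⊢ˢ-⇛ (λ v e → ⊨-stable (λ ¬eψ → ¬ᶠ-elim e (⇒-intro (⊥-elim ∘ ¬eψ))))
                                Δ⊢¬[ψ⇒ψ'])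

    ψ'∈Δ : Δ ψ'
    ψ'∈Δ = proj₁ (proj₂ (executable (⊤-state mcs (U⁻-extension-∈Φ mcs Δ-mcs (λ χ → extends χ ∘ inj₁))) ψ∈Δ))
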